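{- Let $\lambda$ be a partition with empty $2$-core. Then $b(\lambda)\geq 0$, and $b(\lambda)=0$ if and only if every part of $\lambda$ is even.
   Context: A partition $\lambda$ is identified with its Young diagram $\{(i,j):1\le j\le\lambda_i\}$, with conjugate $\lambda'$. It has empty $2$-core if its Young diagram can be tiled by dominoes ($1\times2$ or $2\times1$ rectangles). The statistic $b$ is \[ b(\lambda):=\sum_{(i,j)\in\lambda}(-1)^{\lambda_i+\lambda_j'-i-j+1}(\lambda_i-i). \] -}

module Defs where

open import Data.Nat using (ℕ; zero; suc; _+_; _≥_; _≤?_; _%_)
open import Data.Integer as ℤ using (ℤ; +_; -_)
open import Data.List using (List; []; _∷_; length; map; concatMap; upTo; filter; _++_; foldr)
open import Data.List.Relation.Unary.All using (All)
open import Data.List.Relation.Unary.Linked using (Linked)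
open import Data.Product using (_×_; _,_)
open import Data.Nat using (_>_)

IsPartition : List ℕ → Set
IsPartition lam = Linked _≥_ lam × All (λ p → p > 0) lam

-- Cells are pairs (i , j) with 1-based row i and column j.
Cell : Set
Cell = ℕ × ℕ

-- lam_i with 1-based index; lam_i = 0 for i = 0 or i > ℓ(lam).
part : List ℕ → ℕ → ℕ
part []       _             = 0
part (p ∷ ps) zero          = 0
part (p ∷ ps) (suc zero)    = p
part (p ∷ ps) (suc (suc i)) = part ps (suc i)

conjPart : List ℕ → ℕ → ℕ
conjPart lam j = length (filter (λ p → j ≤? p) lam)

diagramFrom : ℕ → List ℕ → List Cell
diagramFrom i []       = []
diagramFrom i (p ∷ ps) = map (λ j → (i , suc j)) (upTo p) ++ diagramFrom (suc i) ps

diagram : List ℕ → List Cell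
diagram lam = diagramFrom 1 lam

data Domino : Set where
  horiz : Cell → Domino
  vert  : Cell → Domino

dominoCells : Domino → List Cell
dominoCells (horiz (i , j)) = (i , j) ∷ (i , suc j) ∷ []
dominoCells (vert  (i , j)) = (i , j) ∷ (suc i , j) ∷ []

open import Data.List.Relation.Binary.Permutation.Propositional using (_↭_)
open import Data.Product using (∃)

-- A domino tiling of the diagram: a list of dominoes whose cells, counted
-- with multiplicity, are exactly the cells of the diagram (each once).
EmptyTwoCore : List ℕ → Set
EmptyTwoCore lam = ∃ λ (ds : List Domino) → concatMap dominoCells ds ↭ diagram lam

sgn : ℕ → ℤ
sgn n with n % 2
... | zero = + 1
... | suc _ = - (+ 1)

-- Summand at cell (i,j): (-1)^(lam_i + lam'_j - i - j + 1) (lam_i - i).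
-- For cells of the diagram the exponent is the hook length (a natural
-- number); its parity equals that of lam_i + lam'_j + i + j + 1, used here
-- to avoid truncated subtraction.
bTerm : List ℕ → Cell → ℤ
bTerm lam (i , j) =
  sgn (part lam i + conjPart lam j + i + j + 1) ℤ.* (+ part lam i ℤ.- + i)

b : List ℕ → ℤ
b lam = foldr ℤ._+_ (+ 0) (map (bTerm lam) (diagram lam))

{-# OPTIONS --safe #-}
-- Write W(λ) = Σᵢ (−1)ⁱ (λᵢ mod 2) (altParity) and tri w = w(2w+1) ≥ 0.  Peeling off the
-- top row, the hook signs of the first row sum to tri W(λ₂,λ₃,…) − tri W(λ),
-- so the signed hook sum telescopes to −tri W(λ), and then
-- b(λ) + (λ₁ − 1) tri W(λ) = Σᵢ (λᵢ − λᵢ₊₁ + 1) tri W(λᵢ₊₁,λᵢ₊₂,…) ≥ 0.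
-- Up to sign W(λ) is the imbalance of the checkerboard colouring of the
-- diagram, which a domino tiling forces to vanish.  Hence b(λ) is the
-- nonnegative sum on the right, and it is 0 exactly when W vanishes on every
-- suffix of λ, i.e. when every part is even.

module Submission where

open import Defs
open import Data.Nat using (ℕ)
open import Data.Nat.Divisibility using (_∣_)
open import Data.Integer using (+_; _≤_)
open import Data.List using (List)
open import Data.List.Relation.Unary.All using (All)
open import Data.Product using (_×_)
open import Relation.Binary.PropositionalEquality using (_≡_)
open import Function.Bundles using (_⇔_)

open import Data.Nat.Base as ℕ using (zero; suc; _∸_; z≤n; s≤s)
import Data.Nat.Properties as ℕ
open import Data.Nat.Divisibility using (divides)
open import Data.Integer.Base using (ℤ; -[1+_]; -_; _+_; _-_; _*_; +≤+)
import Data.Integer.Properties as ℤ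
open import Data.Integer.Tactic.RingSolver using (solve-∀)
import Data.Nat.Tactic.RingSolver as ℕ
open import Data.List.Base using ([]; _∷_; _++_; map; foldr; upTo; applyUpTo; length; concatMap)
open import Data.List.Properties using (map-++; map-∘; filter-accept; filter-none)
open import Data.List.Relation.Unary.All as All using ([]; _∷_)
open import Data.List.Relation.Unary.AllPairs using (_∷_)
open import Data.List.Relation.Unary.Linked using (Linked; [-]; _∷_; tail)
open import Data.List.Relation.Unary.Linked.Properties using (Linked⇒AllPairs)
open import Data.List.Relation.Binary.Permutation.Propositional using (_↭_; ↭⇒↭ₛ)
open import Data.List.Relation.Binary.Permutation.Propositional.Properties using (map⁺)
open import Data.List.Relation.Binary.Permutation.Setoid.Properties using (foldr-commMonoid)
open import Data.Product using (_,_)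
open import Function.Bundles using (mk⇔)
open import Relation.Binary.PropositionalEquality
  using (refl; sym; trans; cong; cong₂; subst; setoid; module ≡-Reasoning)

∑ : List ℤ → ℤ
∑ = foldr _+_ (+ 0)

∑-++ : ∀ xs ys → ∑ (xs ++ ys) ≡ ∑ xs + ∑ ys
∑-++ []       ys = sym (ℤ.+-identityˡ (∑ ys))
∑-++ (x ∷ xs) ys = trans (cong (_+_ x) (∑-++ xs ys)) (sym (ℤ.+-assoc x (∑ xs) (∑ ys)))

∑-↭ : ∀ {xs ys} → xs ↭ ys → ∑ xs ≡ ∑ ys
∑-↭ p = foldr-commMonoid (setoid ℤ) ℤ.+-0-isCommutativeMonoid (↭⇒↭ₛ p)

∑< : ℕ → (ℕ → ℤ) → ℤ
∑< zero    h = + 0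
∑< (suc n) h = h 0 + ∑< n (λ j → h (suc j))

syntax ∑< n (λ j → e) = ∑[ j < n ] e

∑<-cong : ∀ n {h k : ℕ → ℤ} → (∀ j → j ℕ.< n → h j ≡ k j) → ∑< n h ≡ ∑< n k
∑<-cong zero    eq = refl
∑<-cong (suc n) eq = cong₂ _+_ (eq 0 (s≤s z≤n)) (∑<-cong n (λ j j<n → eq (suc j) (s≤s j<n)))

∑<-+ : ∀ n (h k : ℕ → ℤ) → ∑[ j < n ] (h j + k j) ≡ ∑< n h + ∑< n k
∑<-+ zero    h k = refl
∑<-+ (suc n) h k = trans (cong (_+_ (h 0 + k 0)) (∑<-+ n _ _)) (interchange (h 0) (k 0) _ _)
  where
  interchange : ∀ a b c d → a + b + (c + d) ≡ a + c + (b + d)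
  interchange = solve-∀

∑<-neg : ∀ n (h : ℕ → ℤ) → ∑[ j < n ] (- h j) ≡ - ∑< n h
∑<-neg zero    h = refl
∑<-neg (suc n) h = trans (cong (_+_ (- h 0)) (∑<-neg n _)) (sym (ℤ.neg-distrib-+ (h 0) _))

∑<-*ˡ : ∀ n c (h : ℕ → ℤ) → ∑[ j < n ] (c * h j) ≡ c * ∑< n h
∑<-*ˡ zero    c h = sym (ℤ.*-zeroʳ c)
∑<-*ˡ (suc n) c h = trans (cong (_+_ (c * h 0)) (∑<-*ˡ n c _)) (sym (ℤ.*-distribˡ-+ c (h 0) _))

∑<-split : ∀ m n (h : ℕ → ℤ) → ∑< (m ℕ.+ n) h ≡ ∑< m h + ∑[ j < n ] h (m ℕ.+ j)
∑<-split zero    n h = sym (ℤ.+-identityˡ _)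
∑<-split (suc m) n h = trans (cong (_+_ (h 0)) (∑<-split m n _)) (sym (ℤ.+-assoc (h 0) _ _))

∑-map-applyUpTo : ∀ {A : Set} (h : A → ℤ) (f : ℕ → A) n → ∑ (map h (applyUpTo f n)) ≡ ∑[ j < n ] h (f j)
∑-map-applyUpTo h f zero    = refl
∑-map-applyUpTo h f (suc n) = cong (_+_ (h (f 0))) (∑-map-applyUpTo h (λ j → f (suc j)) n)

sgn-suc : ∀ n → sgn (suc n) ≡ - sgn n
sgn-suc zero    = refl
sgn-suc (suc n) = sym (trans (cong -_ (sgn-suc n)) (ℤ.neg-involutive (sgn n)))

sgn-+ : ∀ m n → sgn (m ℕ.+ n) ≡ sgn m * sgn n
sgn-+ zero    n = sym (ℤ.*-identityˡ (sgn n))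
sgn-+ (suc m) n = begin
  sgn (suc (m ℕ.+ n))  ≡⟨ sgn-suc (m ℕ.+ n) ⟩
  - sgn (m ℕ.+ n)      ≡⟨ cong -_ (sgn-+ m n) ⟩
  - (sgn m * sgn n)    ≡⟨ ℤ.neg-distribˡ-* (sgn m) (sgn n) ⟩
  - sgn m * sgn n      ≡⟨ cong (_* sgn n) (sym (sgn-suc m)) ⟩
  sgn (suc m) * sgn n  ∎
  where open ≡-Reasoning

parity : ℕ → ℤ
parity zero          = + 0
parity (suc zero)    = + 1
parity (suc (suc n)) = parity n

sgn-suc-parity : ∀ n → sgn (suc n) ≡ parity n + parity n - + 1
sgn-suc-parity zero          = refl
sgn-suc-parity (suc zero)    = refl
sgn-suc-parity (suc (suc n)) = sgn-suc-parity n

∑-alternating : ∀ n → ∑[ j < n ] sgn (suc j) ≡ - parity n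
∑-alternating zero          = refl
∑-alternating (suc zero)    = refl
∑-alternating (suc (suc n)) = trans (cong (λ s → - + 1 + (+ 1 + s)) (∑-alternating n)) (cancel (- parity n))
  where
  cancel : ∀ x → - + 1 + (+ 1 + x) ≡ x
  cancel = solve-∀

parity≡0⇒2∣ : ∀ n → parity n ≡ + 0 → 2 ∣ n
parity≡0⇒2∣ zero          _  = divides 0 refl
parity≡0⇒2∣ (suc (suc n)) eq with parity≡0⇒2∣ n eq
... | divides q n≡q*2 = divides (suc q) (cong (λ m → suc (suc m)) n≡q*2)

2∣⇒parity≡0 : ∀ n → 2 ∣ n → parity n ≡ + 0
2∣⇒parity≡0 n (divides q refl) = parity-double q
  where
  parity-double : ∀ q → parity (q ℕ.* 2) ≡ + 0
  parity-double zero    = refl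
  parity-double (suc q) = parity-double q

-- tri w is the triangular number T(2w), or T(−2w−1) when w < 0, hence the
-- codomain ℕ; tri W(λ) is the size of the 2-core of λ.
tri : ℤ → ℕ
tri (+ n)    = n ℕ.* (n ℕ.+ n ℕ.+ 1)
tri -[1+ n ] = suc n ℕ.* (suc n ℕ.+ n)

+tri : ∀ w → + tri w ≡ w * (w + w + + 1)
+tri (+ n)    = ℤ.pos-* n (n ℕ.+ n ℕ.+ 1)
+tri -[1+ n ] = trans (ℤ.pos-* (suc n) (suc n ℕ.+ n)) (sym (negated (+ n)))
  where
  negated : ∀ m → - (+ 1 + m) * (- (+ 1 + m) + - (+ 1 + m) + + 1) ≡ (+ 1 + m) * (+ 1 + m + m)
  negated = solve-∀

tri≡0⇒≡0 : ∀ w → tri w ≡ 0 → w ≡ + 0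
tri≡0⇒≡0 (+ zero)  _  = refl
tri≡0⇒≡0 (+ suc n) ()
tri≡0⇒≡0 -[1+ n ] ()

partsBelowHead : ∀ {p ps} → Linked ℕ._≥_ (p ∷ ps) → All (ℕ._≤ p) ps
partsBelowHead lk with Linked⇒AllPairs (λ y≤x z≤y → ℕ.≤-trans z≤y y≤x) lk
... | below ∷ _ = below

secondPart≤head : ∀ {p ps} → Linked ℕ._≥_ (p ∷ ps) → part ps 1 ℕ.≤ p
secondPart≤head [-]       = z≤n
secondPart≤head (q≤p ∷ _) = q≤p

conjPart-cons : ∀ {p} ps j → suc j ℕ.≤ p → conjPart (p ∷ ps) (suc j) ≡ suc (conjPart ps (suc j))
conjPart-cons ps j j<p = cong length (filter-accept (λ x → suc j ℕ.≤? x) j<p)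

conjPart-beyond : ∀ {m} qs → All (ℕ._≤ m) qs → conjPart qs (suc m) ≡ 0
conjPart-beyond {m} qs qs≤m = cong length (filter-none (λ x → suc m ℕ.≤? x) (All.map ℕ.≤⇒≯ qs≤m))

altParity : List ℕ → ℤ
altParity []       = + 0
altParity (p ∷ ps) = - parity p - altParity ps

columnSigns : List ℕ → ℕ → ℤ
columnSigns μ n = ∑[ j < n ] sgn (conjPart μ (suc j) ℕ.+ suc j)

columnSigns≡ : ∀ μ n → Linked ℕ._≥_ μ → All (ℕ._≤ n) μ →
  columnSigns μ n ≡ - parity n - (altParity μ + altParity μ)
columnSigns≡ []       n _  _           = trans (∑-alternating n) (sym (ℤ.+-identityʳ (- parity n)))
columnSigns≡ (q ∷ qs) n lk (q≤n ∷ _) =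
  subst (λ n → columnSigns (q ∷ qs) n ≡ - parity n - (w′ + w′)) (ℕ.m+[n∸m]≡n q≤n) (split (n ∸ q))
  where
  open ≡-Reasoning
  w w′ : ℤ
  w  = altParity qs
  w′ = altParity (q ∷ qs)
  colSign : ℕ → ℤ
  colSign j = sgn (conjPart (q ∷ qs) (suc j) ℕ.+ suc j)

  -- Columns j ≤ q of q ∷ qs are one cell longer than those of qs; the rest are empty.

  firstColumns : ∑[ j < q ] colSign j ≡ - (- parity q - (w + w))
  firstColumns = begin
    ∑[ j < q ] colSign j
      ≡⟨ ∑<-cong q (λ j j<q → trans (cong (λ c → sgn (c ℕ.+ suc j)) (conjPart-cons qs j j<q))
                                     (sgn-suc (conjPart qs (suc j) ℕ.+ suc j))) ⟩
    ∑[ j < q ] (- sgn (conjPart qs (suc j) ℕ.+ suc j))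
      ≡⟨ ∑<-neg q _ ⟩
    - columnSigns qs q
      ≡⟨ cong -_ (columnSigns≡ qs q (tail lk) (partsBelowHead lk)) ⟩
    - (- parity q - (w + w)) ∎

  emptyColumns : ∀ r → ∑[ j < r ] colSign (q ℕ.+ j) ≡ - parity (q ℕ.+ r) - - parity q
  emptyColumns r = begin
    ∑[ j < r ] colSign (q ℕ.+ j)
      ≡⟨ ∑<-cong r (λ j _ → cong (λ c → sgn (c ℕ.+ suc (q ℕ.+ j)))
           (conjPart-beyond (q ∷ qs) (All.map (λ x≤q → ℕ.≤-trans x≤q (ℕ.m≤m+n q j)) (ℕ.≤-refl ∷ partsBelowHead lk)))) ⟩
    ∑[ j < r ] sgn (suc (q ℕ.+ j))
      ≡⟨ solveFor (∑<-split q r (λ j → sgn (suc j))) ⟩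
    ∑[ j < q ℕ.+ r ] sgn (suc j) - ∑[ j < q ] sgn (suc j)
      ≡⟨ cong₂ _-_ (∑-alternating (q ℕ.+ r)) (∑-alternating q) ⟩
    - parity (q ℕ.+ r) - - parity q ∎
    where
    solveFor : ∀ {x a y} → x ≡ a + y → y ≡ x - a
    solveFor {a = a} {y} refl = cancel a y
      where
      cancel : ∀ a y → y ≡ a + y - a
      cancel = solve-∀

  split : ∀ r → columnSigns (q ∷ qs) (q ℕ.+ r) ≡ - parity (q ℕ.+ r) - (w′ + w′)
  split r = begin
    columnSigns (q ∷ qs) (q ℕ.+ r)
      ≡⟨ ∑<-split q r colSign ⟩
    ∑[ j < q ] colSign j + ∑[ j < r ] colSign (q ℕ.+ j)
      ≡⟨ cong₂ _+_ firstColumns (emptyColumns r) ⟩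
    - (- parity q - (w + w)) + (- parity (q ℕ.+ r) - - parity q)
      ≡⟨ regroup (parity q) (parity (q ℕ.+ r)) w ⟩
    - parity (q ℕ.+ r) - (w′ + w′) ∎
    where
    regroup : ∀ o o′ w → - (- o - (w + w)) + (- o′ - - o) ≡ - o′ - ((- o - w) + (- o - w))
    regroup = solve-∀

rowwiseSum : (Cell → ℤ) → ℕ → List ℕ → ℤ
rowwiseSum f i []       = + 0
rowwiseSum f i (q ∷ qs) = ∑[ j < q ] f (i , suc j) + rowwiseSum f (suc i) qs

∑-diagramFrom : ∀ f i μ → ∑ (map f (diagramFrom i μ)) ≡ rowwiseSum f i μ
∑-diagramFrom f i []       = refl
∑-diagramFrom f i (q ∷ qs) = begin
  ∑ (map f (row ++ diagramFrom (suc i) qs))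
    ≡⟨ cong ∑ (map-++ f row (diagramFrom (suc i) qs)) ⟩
  ∑ (map f row ++ map f (diagramFrom (suc i) qs))
    ≡⟨ ∑-++ (map f row) _ ⟩
  ∑ (map f row) + ∑ (map f (diagramFrom (suc i) qs))
    ≡⟨ cong₂ _+_ (trans (cong ∑ (sym (map-∘ (upTo q)))) (∑-map-applyUpTo _ (λ j → j) q))
                 (∑-diagramFrom f (suc i) qs) ⟩
  rowwiseSum f i (q ∷ qs) ∎
  where
  open ≡-Reasoning
  row : List Cell
  row = map (λ j → (i , suc j)) (upTo q)

rowwiseSum-lowerRows : ∀ {M} (f g : Cell → ℤ) i μ → All (ℕ._≤ M) μ →
  (∀ k j → j ℕ.< M → f (suc (suc k) , suc j) ≡ g (suc k , suc j)) →
  rowwiseSum f (suc (suc i)) μ ≡ rowwiseSum g (suc i) μ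
rowwiseSum-lowerRows f g i []       _            eq = refl
rowwiseSum-lowerRows f g i (q ∷ qs) (q≤M ∷ qs≤M) eq =
  cong₂ _+_ (∑<-cong q (λ j j<q → eq i j (ℕ.<-≤-trans j<q q≤M)))
            (rowwiseSum-lowerRows f g (suc i) qs qs≤M eq)

rowwiseSum-sub : ∀ (f g : Cell → ℤ) i μ →
  rowwiseSum (λ c → f c - g c) i μ ≡ rowwiseSum f i μ - rowwiseSum g i μ
rowwiseSum-sub f g i []       = refl
rowwiseSum-sub f g i (q ∷ qs) = begin
  ∑[ j < q ] (f (i , suc j) - g (i , suc j)) + rowwiseSum (λ c → f c - g c) (suc i) qs
    ≡⟨ cong₂ _+_ (trans (∑<-+ q _ _) (cong (_+_ (∑[ j < q ] f (i , suc j))) (∑<-neg q _)))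
                 (rowwiseSum-sub f g (suc i) qs) ⟩
  ∑[ j < q ] f (i , suc j) - ∑[ j < q ] g (i , suc j) + (rowwiseSum f (suc i) qs - rowwiseSum g (suc i) qs)
    ≡⟨ interchange (∑[ j < q ] f (i , suc j)) (∑[ j < q ] g (i , suc j)) _ _ ⟩
  rowwiseSum f i (q ∷ qs) - rowwiseSum g i (q ∷ qs) ∎
  where
  open ≡-Reasoning
  interchange : ∀ a b c d → a - b + (c - d) ≡ a + c - (b + d)
  interchange = solve-∀

hookSign : List ℕ → Cell → ℤ
hookSign μ (i , j) = sgn (part μ i ℕ.+ conjPart μ j ℕ.+ i ℕ.+ j ℕ.+ 1)

signedHookSum : List ℕ → ℤ
signedHookSum μ = rowwiseSum (hookSign μ) 1 μ

module PeelTopRow (p : ℕ) (ps : List ℕ) where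

  hookSign-topRow : ∀ j → j ℕ.< p →
    hookSign (p ∷ ps) (1 , suc j) ≡ sgn (suc p) * sgn (conjPart ps (suc j) ℕ.+ suc j)
  hookSign-topRow j j<p = begin
    sgn (p ℕ.+ conjPart (p ∷ ps) (suc j) ℕ.+ 1 ℕ.+ suc j ℕ.+ 1)
      ≡⟨ cong (λ c → sgn (p ℕ.+ c ℕ.+ 1 ℕ.+ suc j ℕ.+ 1)) (conjPart-cons ps j j<p) ⟩
    sgn (p ℕ.+ suc c ℕ.+ 1 ℕ.+ suc j ℕ.+ 1)
      ≡⟨ cong sgn (exponent p c j) ⟩
    sgn (suc p ℕ.+ (c ℕ.+ suc j))
      ≡⟨ sgn-+ (suc p) (c ℕ.+ suc j) ⟩
    sgn (suc p) * sgn (c ℕ.+ suc j) ∎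
    where
    open ≡-Reasoning
    c : ℕ
    c = conjPart ps (suc j)
    exponent : ∀ p c j → p ℕ.+ suc c ℕ.+ 1 ℕ.+ suc j ℕ.+ 1 ≡ 2 ℕ.+ (suc p ℕ.+ (c ℕ.+ suc j))
    exponent = ℕ.solve-∀

  hookSign-lowerRow : ∀ k j → j ℕ.< p → hookSign (p ∷ ps) (suc (suc k) , suc j) ≡ hookSign ps (suc k , suc j)
  hookSign-lowerRow k j j<p =
    trans (cong (λ c → sgn (a ℕ.+ c ℕ.+ suc (suc k) ℕ.+ suc j ℕ.+ 1)) (conjPart-cons ps j j<p))
          (cong sgn (exponent a (conjPart ps (suc j)) k j))
    where
    a : ℕ
    a = part ps (suc k)
    exponent : ∀ a c k j → a ℕ.+ suc c ℕ.+ suc (suc k) ℕ.+ suc j ℕ.+ 1 ≡ 2 ℕ.+ (a ℕ.+ c ℕ.+ suc k ℕ.+ suc j ℕ.+ 1)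
    exponent = ℕ.solve-∀

  bTerm-lowerRow : ∀ k j → j ℕ.< p →
    bTerm (p ∷ ps) (suc (suc k) , suc j) ≡ bTerm ps (suc k , suc j) - hookSign ps (suc k , suc j)
  bTerm-lowerRow k j j<p =
    trans (cong (_* (+ part ps (suc k) - + suc (suc k))) (hookSign-lowerRow k j j<p))
          (distrib (hookSign ps (suc k , suc j)) (+ part ps (suc k)) (+ suc k))
    where
    distrib : ∀ s x y → s * (x - (+ 1 + y)) ≡ s * (x - y) - s
    distrib = solve-∀

  topRowHookSum : ∑[ j < p ] hookSign (p ∷ ps) (1 , suc j) ≡ sgn (suc p) * columnSigns ps p
  topRowHookSum = trans (∑<-cong p hookSign-topRow) (∑<-*ˡ p (sgn (suc p)) _)

  topRowBTermSum : ∑[ j < p ] bTerm (p ∷ ps) (1 , suc j) ≡ (+ p - + 1) * (sgn (suc p) * columnSigns ps p)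
  topRowBTermSum = begin
    ∑[ j < p ] (hookSign (p ∷ ps) (1 , suc j) * (+ p - + 1))
      ≡⟨ ∑<-cong p (λ j _ → ℤ.*-comm (hookSign (p ∷ ps) (1 , suc j)) (+ p - + 1)) ⟩
    ∑[ j < p ] ((+ p - + 1) * hookSign (p ∷ ps) (1 , suc j))
      ≡⟨ ∑<-*ˡ p (+ p - + 1) _ ⟩
    (+ p - + 1) * ∑[ j < p ] hookSign (p ∷ ps) (1 , suc j)
      ≡⟨ cong (_*_ (+ p - + 1)) topRowHookSum ⟩
    (+ p - + 1) * (sgn (suc p) * columnSigns ps p) ∎
    where open ≡-Reasoning

  module _ (ps≤p : All (ℕ._≤ p) ps) where

    signedHookSum-cons : signedHookSum (p ∷ ps) ≡ sgn (suc p) * columnSigns ps p + signedHookSum ps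
    signedHookSum-cons = cong₂ _+_ topRowHookSum
      (rowwiseSum-lowerRows (hookSign (p ∷ ps)) (hookSign ps) 0 ps ps≤p hookSign-lowerRow)

    rowwiseSum-bTerm-cons :
      rowwiseSum (bTerm (p ∷ ps)) 1 (p ∷ ps)
        ≡ (+ p - + 1) * (sgn (suc p) * columnSigns ps p) + (rowwiseSum (bTerm ps) 1 ps - signedHookSum ps)
    rowwiseSum-bTerm-cons = cong₂ _+_ topRowBTermSum
      (trans (rowwiseSum-lowerRows (bTerm (p ∷ ps)) (λ c → bTerm ps c - hookSign ps c) 0 ps ps≤p bTerm-lowerRow)
             (rowwiseSum-sub (bTerm ps) (hookSign ps) 1 ps))

columnSigns-telescope : ∀ {p ps} → Linked ℕ._≥_ (p ∷ ps) →
  sgn (suc p) * columnSigns ps p ≡ + tri (altParity ps) - + tri (altParity (p ∷ ps))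
columnSigns-telescope {p} {ps} lk = begin
  sgn (suc p) * columnSigns ps p
    ≡⟨ cong₂ _*_ (sgn-suc-parity p) (columnSigns≡ ps p (tail lk) (partsBelowHead lk)) ⟩
  (o + o - + 1) * (- o - (w + w))
    ≡⟨ telescope o w ⟩
  w * (w + w + + 1) - (- o - w) * ((- o - w) + (- o - w) + + 1)
    ≡⟨ sym (cong₂ _-_ (+tri w) (+tri (- o - w))) ⟩
  + tri w - + tri (- o - w) ∎
  where
  open ≡-Reasoning
  o w : ℤ
  o = parity p
  w = altParity ps
  telescope : ∀ o w → (o + o - + 1) * (- o - (w + w)) ≡ w * (w + w + + 1) - (- o - w) * ((- o - w) + (- o - w) + + 1)
  telescope = solve-∀

signedHookSum≡-tri : ∀ μ → Linked ℕ._≥_ μ → signedHookSum μ ≡ - + tri (altParity μ)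
signedHookSum≡-tri []       _  = refl
signedHookSum≡-tri (p ∷ ps) lk = begin
  signedHookSum (p ∷ ps)
    ≡⟨ PeelTopRow.signedHookSum-cons p ps (partsBelowHead lk) ⟩
  sgn (suc p) * columnSigns ps p + signedHookSum ps
    ≡⟨ cong₂ _+_ (columnSigns-telescope lk) (signedHookSum≡-tri ps (tail lk)) ⟩
  + tri (altParity ps) - + tri (altParity (p ∷ ps)) + - + tri (altParity ps)
    ≡⟨ cancel (+ tri (altParity ps)) (+ tri (altParity (p ∷ ps))) ⟩
  - + tri (altParity (p ∷ ps)) ∎
  where
  open ≡-Reasoning
  cancel : ∀ x x′ → x - x′ + - x ≡ - x′
  cancel = solve-∀

weight : List ℕ → ℕ
weight []       = 0
weight (p ∷ ps) = suc (p ∸ part ps 1) ℕ.* tri (altParity ps) ℕ.+ weight ps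

rowwiseSum-bTerm≡weight : ∀ μ → Linked ℕ._≥_ μ →
  rowwiseSum (bTerm μ) 1 μ + (+ part μ 1 - + 1) * + tri (altParity μ) ≡ + weight μ
rowwiseSum-bTerm≡weight []       _  = refl
rowwiseSum-bTerm≡weight (p ∷ ps) lk = begin
  B′ + (+ p - + 1) * x′
    ≡⟨ cong (_+ (+ p - + 1) * x′) B′≡ ⟩
  (+ p - + 1) * (x - x′) + (B - - x) + (+ p - + 1) * x′
    ≡⟨ telescope (+ p) x x′ B ⟩
  + p * x + B
    ≡⟨ cong (λ P → P * x + B) (cong +_ (sym (ℕ.m+[n∸m]≡n (secondPart≤head lk)))) ⟩
  (+ h + + d) * x + B
    ≡⟨ regroup (+ h) (+ d) x B ⟩
  (+ 1 + + d) * x + (B + (+ h - + 1) * x)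
    ≡⟨ cong₂ _+_ (sym (ℤ.pos-* (suc d) (tri w))) (rowwiseSum-bTerm≡weight ps (tail lk)) ⟩
  + weight (p ∷ ps) ∎
  where
  open ≡-Reasoning
  h d : ℕ
  h  = part ps 1
  d  = p ∸ h
  w x x′ B B′ : ℤ
  w  = altParity ps
  x  = + tri w
  x′ = + tri (altParity (p ∷ ps))
  B  = rowwiseSum (bTerm ps) 1 ps
  B′ = rowwiseSum (bTerm (p ∷ ps)) 1 (p ∷ ps)
  B′≡ : B′ ≡ (+ p - + 1) * (x - x′) + (B - - x)
  B′≡ = trans (PeelTopRow.rowwiseSum-bTerm-cons p ps (partsBelowHead lk))
              (cong₂ (λ t D → (+ p - + 1) * t + (B - D)) (columnSigns-telescope lk) (signedHookSum≡-tri ps (tail lk)))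
  telescope : ∀ P x x′ B → (P - + 1) * (x - x′) + (B - - x) + (P - + 1) * x′ ≡ P * x + B
  telescope = solve-∀
  regroup : ∀ H d x B → (H + d) * x + B ≡ (+ 1 + d) * x + (B + (H - + 1) * x)
  regroup = solve-∀

checkerboard : Cell → ℤ
checkerboard (i , j) = sgn (i ℕ.+ j)

∑-sgn-consecutive : ∀ n {m} → m ≡ suc n → ∑ (sgn n ∷ sgn m ∷ []) ≡ + 0
∑-sgn-consecutive n refl = trans (cong (λ s → sgn n + (s + + 0)) (sgn-suc n)) (cancel (sgn n))
  where
  cancel : ∀ s → s + (- s + + 0) ≡ + 0
  cancel = solve-∀

∑-checkerboard-domino : ∀ d → ∑ (map checkerboard (dominoCells d)) ≡ + 0
∑-checkerboard-domino (horiz (i , j)) = ∑-sgn-consecutive (i ℕ.+ j) (ℕ.+-suc i j)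
∑-checkerboard-domino (vert  (i , j)) = ∑-sgn-consecutive (i ℕ.+ j) refl

∑-checkerboard-tiling : ∀ ds → ∑ (map checkerboard (concatMap dominoCells ds)) ≡ + 0
∑-checkerboard-tiling []       = refl
∑-checkerboard-tiling (d ∷ ds) = begin
  ∑ (map checkerboard (dominoCells d ++ concatMap dominoCells ds))
    ≡⟨ cong ∑ (map-++ checkerboard (dominoCells d) _) ⟩
  ∑ (map checkerboard (dominoCells d) ++ map checkerboard (concatMap dominoCells ds))
    ≡⟨ ∑-++ (map checkerboard (dominoCells d)) _ ⟩
  ∑ (map checkerboard (dominoCells d)) + ∑ (map checkerboard (concatMap dominoCells ds))
    ≡⟨ cong₂ _+_ (∑-checkerboard-domino d) (∑-checkerboard-tiling ds) ⟩
  + 0 ∎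
  where open ≡-Reasoning

rowwiseSum-checkerboard : ∀ i μ → rowwiseSum checkerboard i μ ≡ sgn i * altParity μ
rowwiseSum-checkerboard i []       = sym (ℤ.*-zeroʳ (sgn i))
rowwiseSum-checkerboard i (q ∷ qs) = begin
  ∑[ j < q ] sgn (i ℕ.+ suc j) + rowwiseSum checkerboard (suc i) qs
    ≡⟨ cong₂ _+_ firstRow (rowwiseSum-checkerboard (suc i) qs) ⟩
  sgn i * - parity q + sgn (suc i) * altParity qs
    ≡⟨ cong (λ s → sgn i * - parity q + s * altParity qs) (sgn-suc i) ⟩
  sgn i * - parity q + - sgn i * altParity qs
    ≡⟨ factor (sgn i) (parity q) (altParity qs) ⟩
  sgn i * altParity (q ∷ qs) ∎
  where
  open ≡-Reasoning
  firstRow : ∑[ j < q ] sgn (i ℕ.+ suc j) ≡ sgn i * - parity q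
  firstRow = trans (∑<-cong q (λ j _ → sgn-+ i (suc j)))
                   (trans (∑<-*ˡ q (sgn i) _) (cong (_*_ (sgn i)) (∑-alternating q)))
  factor : ∀ s o w → s * - o + - s * w ≡ s * (- o - w)
  factor = solve-∀

emptyTwoCore⇒altParity≡0 : ∀ μ → EmptyTwoCore μ → altParity μ ≡ + 0
emptyTwoCore⇒altParity≡0 μ (ds , tiling) = ℤ.neg-injective (begin
  - altParity μ                               ≡⟨ ℤ.-1*i≡-i (altParity μ) ⟨
  sgn 1 * altParity μ                         ≡⟨ rowwiseSum-checkerboard 1 μ ⟨
  rowwiseSum checkerboard 1 μ                 ≡⟨ ∑-diagramFrom checkerboard 1 μ ⟨
  ∑ (map checkerboard (diagram μ))            ≡⟨ ∑-↭ (map⁺ checkerboard tiling) ⟨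
  ∑ (map checkerboard (concatMap dominoCells ds)) ≡⟨ ∑-checkerboard-tiling ds ⟩
  + 0                                         ∎)
  where open ≡-Reasoning

b≡weight : ∀ μ → Linked ℕ._≥_ μ → altParity μ ≡ + 0 → b μ ≡ + weight μ
b≡weight μ lk balanced = begin
  b μ                                                   ≡⟨ ∑-diagramFrom (bTerm μ) 1 μ ⟩
  B                                                     ≡⟨ ℤ.+-identityʳ B ⟨
  B + + 0                                               ≡⟨ cong (_+_ B) (ℤ.*-zeroʳ (+ part μ 1 - + 1)) ⟨
  B + (+ part μ 1 - + 1) * + tri (+ 0)                  ≡⟨ cong (λ w → B + (+ part μ 1 - + 1) * + tri w) balanced ⟨
  B + (+ part μ 1 - + 1) * + tri (altParity μ)          ≡⟨ rowwiseSum-bTerm≡weight μ lk ⟩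
  + weight μ                                            ∎
  where
  open ≡-Reasoning
  B : ℤ
  B = rowwiseSum (bTerm μ) 1 μ

allEven⇒altParity≡0 : ∀ {μ} → All (2 ∣_) μ → altParity μ ≡ + 0
allEven⇒altParity≡0 []                 = refl
allEven⇒altParity≡0 {p ∷ _} (2∣p ∷ evens)
  rewrite 2∣⇒parity≡0 p 2∣p | allEven⇒altParity≡0 evens = refl

allEven⇒weight≡0 : ∀ {μ} → All (2 ∣_) μ → weight μ ≡ 0
allEven⇒weight≡0 []                             = refl
allEven⇒weight≡0 {p ∷ ps} (_ ∷ evens)
  rewrite allEven⇒altParity≡0 evens | allEven⇒weight≡0 evens =
  trans (ℕ.+-identityʳ _) (ℕ.*-zeroʳ (suc (p ∸ part ps 1)))

weight≡0⇒allEven : ∀ μ → altParity μ ≡ + 0 → weight μ ≡ 0 → All (2 ∣_) μ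
weight≡0⇒allEven []       _        _        = []
weight≡0⇒allEven (p ∷ ps) balanced weight≡0 =
  parity≡0⇒2∣ p parity≡0 ∷ weight≡0⇒allEven ps tailBalanced (ℕ.m+n≡0⇒n≡0 _ weight≡0)
  where
  tailBalanced : altParity ps ≡ + 0
  tailBalanced = tri≡0⇒≡0 (altParity ps)
    (ℕ.m+n≡0⇒m≡0 (tri (altParity ps)) (ℕ.m+n≡0⇒m≡0 (suc (p ∸ part ps 1) ℕ.* tri (altParity ps)) weight≡0))
  parity≡0 : parity p ≡ + 0
  parity≡0 = trans (negate (parity p)) (cong -_ (subst (λ w → - parity p - w ≡ + 0) tailBalanced balanced))
    where
    negate : ∀ o → o ≡ - (- o - + 0)
    negate = solve-∀

lemma2p2 : (lam : List ℕ) → IsPartition lam → EmptyTwoCore lam →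
    (+ 0 ≤ b lam) × (b lam ≡ + 0 ⇔ All (2 ∣_) lam)
lemma2p2 lam (decreasing , _) tiling =
  subst (+ 0 ≤_) (sym b≡) (+≤+ z≤n) ,
  mk⇔ (λ b≡0 → weight≡0⇒allEven lam balanced (ℤ.+-injective (trans (sym b≡) b≡0)))
      (λ evens → trans b≡ (cong +_ (allEven⇒weight≡0 evens)))
  where
  balanced : altParity lam ≡ + 0
  balanced = emptyTwoCore⇒altParity≡0 lam tiling
  b≡ : b lam ≡ + weight lam
  b≡ = b≡weight lam decreasing balanced
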